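{- Consider the threshold-perturbed proportional allocation algorithm (described in the context) run for $\tau\ge1$ rounds on an allocation instance $(G=(L\cup R,E),\mathsf{C})$, with $\epsilon\in(0,1/4]$ and parameters $k_{v,r}$ satisfying $\frac1k\le k_{v,r}\le k$ for all $v,r$, for some number $k$ with $\epsilon\le\frac1k$. After all rounds have completed, $$OPT\le(1+(k+2)\epsilon)\,\mathsf{MatchWeight}+|\mathsf{N}(\mathcal{L}_{2\tau})|.$$
   Context: Allocation instance: bipartite graph $G=(L\cup R,E)$, integer capacities $\mathsf{C}_v\ge1$ for $v\in R$; $\mathsf{N}_w$ is the neighborhood of $w$, $\mathsf{N}(S)=\bigcup_{v\in S}\mathsf{N}_v$. A fractional allocation assigns $\mathsf{x}_{u,v}\in[0,1]$ to each edge with $\sum_{v\in\mathsf{N}_u}\mathsf{x}_{u,v}\le1$ ($u\in L$) and $\sum_{u\in\mathsf{N}_v}\mathsf{x}_{u,v}\le\mathsf{C}_v$ ($v\in R$); $OPT$ is the maximum total weight $\sum\mathsf{x}_{u,v}$ of a fractional allocation. Threshold-perturbed proportional allocation algorithm with inputs $\tau\ge1$, $\epsilon\in(0,1/4]$ and positive reals $\{k_{v,r}\}$: initially $\beta_v=1$ for $v\in R$. For rounds $r=1,\dots,\tau$: (a) every $u\in L$ sets $\mathsf{x}_{u,v}=\beta_v/\sum_{v'\in\mathsf{N}_u}\beta_{v'}$; (b) every $v\in R$ sets $\mathsf{alloc}_v=\sum_{u\in\mathsf{N}_v}\mathsf{x}_{u,v}$; (c) $\beta_v\leftarrow\beta_v(1+\epsilon)$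 if $\mathsf{alloc}_v\le\mathsf{C}_v/(1+k_{v,r}\epsilon)$, $\beta_v\leftarrow\beta_v/(1+\epsilon)$ if $\mathsf{alloc}_v\ge\mathsf{C}_v(1+k_{v,r}\epsilon)$, unchanged otherwise. Afterwards, with $\mathsf{x},\mathsf{alloc}$ from round $\tau$, $\mathsf{x}'_{u,v}=\frac{\mathsf{C}_v}{\mathsf{alloc}_v}\mathsf{x}_{u,v}$ if $\mathsf{alloc}_v>\mathsf{C}_v$, else $\mathsf{x}_{u,v}$; $\mathsf{MatchWeight}=\sum_{(u,v)\in E}\mathsf{x}'_{u,v}$. Level sets: $\mathcal{L}_j=\{v\in R:\beta_v=(1+\epsilon)^{j-\tau}\}$ for $0\le j\le2\tau$, with final $\beta$ values.
   Formalization: The parameters ε, k and $k_{v,r}$ are rational rather than real, and the fractional allocations whose weight is bounded have rational entries. -}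

module Defs where

open import Data.Nat as ℕ using (ℕ; zero; suc)
open import Data.Fin using (Fin; zero; suc)
open import Data.Bool using (Bool; true; false; if_then_else_)
open import Data.Rational using (ℚ; 0ℚ; 1ℚ; _+_; _*_; _÷_; _≤_; _<_; _/_; ≢-nonZero)
open import Data.Rational.Properties using (_≟_; _≤?_; _<?_)
open import Data.Integer using (+_)
open import Relation.Nullary using (yes; no)
open import Relation.Binary.PropositionalEquality using (_≡_)

sumFin : (n : ℕ) → (Fin n → ℚ) → ℚ
sumFin zero    f = 0ℚ
sumFin (suc n) f = f zero + sumFin n (λ i → f (suc i))

countFin : (n : ℕ) → (Fin n → Bool) → ℕ
countFin zero    p = 0
countFin (suc n) p = (if p zero then 1 else 0) ℕ.+ countFin n (λ i → p (suc i))

anyFin : (n : ℕ) → (Fin n → Bool) → Bool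
anyFin zero    p = false
anyFin (suc n) p = if p zero then true else anyFin n (λ i → p (suc i))

ℕtoℚ : ℕ → ℚ
ℕtoℚ c = (+ c) / 1

-- total division: p / q, and 0 when q = 0 (only used where q ≠ 0 matters)
divℚ : ℚ → ℚ → ℚ
divℚ p q with q ≟ 0ℚ
... | yes _  = 0ℚ
... | no q≢0 = _÷_ p q {{≢-nonZero q≢0}}

powℚ : ℚ → ℕ → ℚ
powℚ b zero    = 1ℚ
powℚ b (suc n) = b * powℚ b n

-- Allocation instance: L = Fin m, R = Fin n, edge relation adj,
-- integer capacities cap v ≥ 1 (the ≥ 1 is a hypothesis of the theorem).

record Instance : Set where
  field
    m   : ℕ
    n   : ℕ
    adj : Fin m → Fin n → Bool
    cap : Fin n → ℕ

module _ (I : Instance) where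
  open Instance I

  record IsFracAlloc (y : Fin m → Fin n → ℚ) : Set where
    field
      nonneg   : ∀ u v → 0ℚ ≤ y u v
      le-one   : ∀ u v → y u v ≤ 1ℚ
      non-edge : ∀ u v → adj u v ≡ false → y u v ≡ 0ℚ
      left     : ∀ u → sumFin n (λ v → y u v) ≤ 1ℚ
      right    : ∀ v → sumFin m (λ u → y u v) ≤ ℕtoℚ (cap v)

  weight : (Fin m → Fin n → ℚ) → ℚ
  weight y = sumFin m (λ u → sumFin n (λ v → y u v))

  -- Threshold-perturbed proportional allocation with parameters
  -- ε and k_{v,r} = kk v r (r = 1, …, τ).

  module Algorithm (ε : ℚ) (kk : Fin n → ℕ → ℚ) where

    xOf : (Fin n → ℚ) → Fin m → Fin n → ℚ
    xOf β u v = if adj u v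
                then divℚ (β v) (sumFin n (λ v' → if adj u v' then β v' else 0ℚ))
                else 0ℚ

    allocOf : (Fin n → ℚ) → Fin n → ℚ
    allocOf β v = sumFin m (λ u → if adj u v then xOf β u v else 0ℚ)

    update : ℕ → (Fin n → ℚ) → Fin n → ℚ
    update r β v with allocOf β v ≤? divℚ (ℕtoℚ (cap v)) (1ℚ + kk v r * ε)
    ... | yes _ = β v * (1ℚ + ε)
    ... | no _ with ℕtoℚ (cap v) * (1ℚ + kk v r * ε) ≤? allocOf β v
    ...   | yes _ = divℚ (β v) (1ℚ + ε)
    ...   | no _  = β v

    -- β after rounds 1..r have completed (β at the start of round r+1)
    βafter : ℕ → Fin n → ℚ
    βafter zero    v = 1ℚ
    βafter (suc r) v = update (suc r) (βafter r) v

    -- x and alloc computed in round τ (from β at the start of round τ)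
    xFinal : ℕ → Fin m → Fin n → ℚ
    xFinal τ = xOf (βafter (τ ℕ.∸ 1))

    allocFinal : ℕ → Fin n → ℚ
    allocFinal τ = allocOf (βafter (τ ℕ.∸ 1))

    x' : ℕ → Fin m → Fin n → ℚ
    x' τ u v with ℕtoℚ (cap v) <? allocFinal τ v
    ... | yes _ = divℚ (ℕtoℚ (cap v)) (allocFinal τ v) * xFinal τ u v
    ... | no _  = xFinal τ u v

    MatchWeight : ℕ → ℚ
    MatchWeight τ = weight (x' τ)

    -- membership in the top level set 𝓛_{2τ}: final β_v = (1+ε)^τ
    inTopLevel : ℕ → Fin n → Bool
    inTopLevel τ v with βafter τ v ≟ powℚ (1ℚ + ε) τ
    ... | yes _ = true
    ... | no _  = false

    sizeNTop : ℕ → ℕ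
    sizeNTop τ = countFin m (λ u → anyFin n (λ v → if adj u v then inTopLevel τ v else false))

-- Call v covered in a round if C_v ≤ D · alloc_v, where D = 1 + (k + 2)ε. Every β grows by
-- at most the factor 1 + ε per round, so x_{u,v} = β_v / Σ_{N_u} β shrinks by at most 1 + ε
-- times the factor by which β_v itself shrinks (allocOf-≤). A round that does not raise β_v
-- certifies alloc_v > C_v / (1 + k_{v,r} ε), and covers v in the next round at the cost of a
-- factor (1 + ε)(1 + kε) ≤ D if β_v is held, or (1 + ε)² ≤ D if it is lowered (then
-- alloc_v ≥ C_v, and ε ≤ k since 1/k ≤ k_{v,r} ≤ k forces k ≥ 1); raising β_v never
-- decreases alloc_v. Hence every v outside the top level set 𝓛_{2τ}, i.e. every v not raised in all
-- rounds, is covered in the final round, and then C_v ≤ D · min (C_v, alloc_v) = D · Σ_u x'_{u,v}.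
-- Finally N(𝓛_{2τ}) ∪ (R ∖ 𝓛_{2τ}) is a fractional vertex cover, and weak duality bounds every
-- allocation by |N(𝓛_{2τ})| + Σ_{v ∉ 𝓛_{2τ}} C_v ≤ |N(𝓛_{2τ})| + D · MatchWeight.

{-# OPTIONS --safe #-}
module Submission where

open import Defs
open import Data.Nat as ℕ using (ℕ; zero; suc)
open import Data.Fin using (Fin; zero; suc)
open import Data.Bool using (Bool; true; false; if_then_else_)
open import Data.Rational
  using (ℚ; 0ℚ; 1ℚ; _+_; _*_; _≤_; _<_; _/_; _⊓_; 1/_; ≢-nonZero; positive; nonNegative)
open import Data.Rational.Properties
open import Data.Rational.Solver using (module +-*-Solver)
open import Data.Integer using (+_)
import Data.Nat.Coprimality as Coprime
import Data.Nat.Properties as ℕ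
import Data.Integer.Properties as ℤ
open import Function using (_∘_)
open import Relation.Binary.PropositionalEquality
  using (_≡_; refl; sym; trans; cong; cong₂; subst; subst₂; module ≡-Reasoning)
open import Relation.Nullary using (yes; no; contradiction)
open import Data.Empty using (⊥-elim)
open import Data.Product using (_×_; _,_; proj₁; proj₂)
open import Data.Sum using (_⊎_; inj₁; inj₂; [_,_])
open import Algebra.Bundles using (Ring)
open import Algebra.Properties.Semiring.Sum (Ring.semiring +-*-ring)
  using (sum; sum-cong-≗; sum-replicate-zero; ∑-distrib-+; ∑-comm; *-distribˡ-sum)

private variable
  a b c p q r p′ q′ : ℚ

0<1 : 0ℚ < 1ℚ
0<1 = positive⁻¹ 1ℚ

p≤p+q : 0ℚ ≤ q → p ≤ p + q
p≤p+q {q} {p} 0≤q = subst (_≤ p + q) (+-identityʳ p) (+-monoʳ-≤ p 0≤q)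

*-monoʳ-≤ : 0ℚ ≤ r → p ≤ q → r * p ≤ r * q
*-monoʳ-≤ {r} 0≤r = *-monoˡ-≤-nonNeg r {{nonNegative 0≤r}}

*-monoˡ-≤ : 0ℚ ≤ r → p ≤ q → p * r ≤ q * r
*-monoˡ-≤ {r} 0≤r = *-monoʳ-≤-nonNeg r {{nonNegative 0≤r}}

p≤q*p : 0ℚ ≤ p → 1ℚ ≤ q → p ≤ q * p
p≤q*p {p} {q} 0≤p 1≤q = subst (_≤ q * p) (*-identityˡ p) (*-monoˡ-≤ 0≤p 1≤q)

*-pos : 0ℚ < p → 0ℚ < q → 0ℚ < p * q
*-pos {p} {q} 0<p 0<q = positive⁻¹ (p * q) {{pos*pos⇒pos p {{positive 0<p}} q {{positive 0<q}}}}

*-nonNeg : 0ℚ ≤ p → 0ℚ ≤ q → 0ℚ ≤ p * q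
*-nonNeg {p} {q} 0≤p 0≤q =
  nonNegative⁻¹ (p * q) {{nonNeg*nonNeg⇒nonNeg p {{nonNegative 0≤p}} q {{nonNegative 0≤q}}}}

1≤p*q⇒q≤p⇒1≤p : 0ℚ ≤ p → 1ℚ ≤ p * q → q ≤ p → 1ℚ ≤ p
1≤p*q⇒q≤p⇒1≤p {p} {q} 0≤p 1≤p*q q≤p = ≮⇒≥ λ p<1 → <-irrefl refl (begin-strict
  1ℚ       ≤⟨ 1≤p*q ⟩
  p * q    ≤⟨ *-monoʳ-≤ 0≤p q≤p ⟩
  p * p    ≤⟨ *-monoˡ-≤ 0≤p (<⇒≤ p<1) ⟩
  1ℚ * p   ≡⟨ *-identityˡ p ⟩
  p        <⟨ p<1 ⟩
  1ℚ       ∎)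
  where open ≤-Reasoning

sumFin≡sum : ∀ n (f : Fin n → ℚ) → sumFin n f ≡ sum f
sumFin≡sum zero    f = refl
sumFin≡sum (suc n) f = cong (λ s → f zero + s) (sumFin≡sum n (f ∘ suc))

module _ (n : ℕ) where

  sumFin-cong : ∀ {f g : Fin n → ℚ} → (∀ i → f i ≡ g i) → sumFin n f ≡ sumFin n g
  sumFin-cong {f} {g} h = trans (sumFin≡sum n f) (trans (sum-cong-≗ h) (sym (sumFin≡sum n g)))

  sumFin-zero : sumFin n (λ _ → 0ℚ) ≡ 0ℚ
  sumFin-zero = trans (sumFin≡sum n _) (sum-replicate-zero n)

  sumFin-distrib-+ : ∀ (f g : Fin n → ℚ) → sumFin n (λ i → f i + g i) ≡ sumFin n f + sumFin n g
  sumFin-distrib-+ f g = trans (sumFin≡sum n _)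
    (trans (∑-distrib-+ f g) (sym (cong₂ _+_ (sumFin≡sum n f) (sumFin≡sum n g))))

  *-distribˡ-sumFin : ∀ c (f : Fin n → ℚ) → c * sumFin n f ≡ sumFin n (λ i → c * f i)
  *-distribˡ-sumFin c f = trans (cong (c *_) (sumFin≡sum n f))
    (trans (*-distribˡ-sum c f) (sym (sumFin≡sum n _)))

sumFin-comm : ∀ m n (f : Fin m → Fin n → ℚ) →
  sumFin m (λ i → sumFin n (f i)) ≡ sumFin n (λ j → sumFin m (λ i → f i j))
sumFin-comm m n f = begin
  sumFin m (λ i → sumFin n (f i))            ≡⟨ sumFin≡sum m _ ⟩
  sum (λ i → sumFin n (f i))                 ≡⟨ sum-cong-≗ (λ i → sumFin≡sum n (f i)) ⟩
  sum (λ i → sum (f i))                      ≡⟨ ∑-comm f ⟩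
  sum (λ j → sum (λ i → f i j))              ≡⟨ sum-cong-≗ (λ j → sumFin≡sum m (λ i → f i j)) ⟨
  sum (λ j → sumFin m (λ i → f i j))         ≡⟨ sumFin≡sum n _ ⟨
  sumFin n (λ j → sumFin m (λ i → f i j))    ∎
  where open ≡-Reasoning

sumFin-mono : ∀ n {f g : Fin n → ℚ} → (∀ i → f i ≤ g i) → sumFin n f ≤ sumFin n g
sumFin-mono zero    _ = ≤-refl
sumFin-mono (suc n) h = +-mono-≤ (h zero) (sumFin-mono n (h ∘ suc))

sumFin-nonNeg : ∀ n {f : Fin n → ℚ} → (∀ i → 0ℚ ≤ f i) → 0ℚ ≤ sumFin n f
sumFin-nonNeg zero    _ = ≤-refl
sumFin-nonNeg (suc n) h = +-mono-≤ (h zero) (sumFin-nonNeg n (h ∘ suc))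

sumFin-pos : ∀ n {f : Fin n → ℚ} → (∀ i → 0ℚ ≤ f i) → ∀ i → 0ℚ < f i → 0ℚ < sumFin n f
sumFin-pos (suc n) h zero    0<f0 = +-mono-<-≤ 0<f0 (sumFin-nonNeg n (h ∘ suc))
sumFin-pos (suc n) h (suc i) 0<fi = +-mono-≤-< (h zero) (sumFin-pos n (h ∘ suc) i 0<fi)

ℕtoℚ-suc : ∀ c → ℕtoℚ (suc c) ≡ 1ℚ + ℕtoℚ c
ℕtoℚ-suc c
  rewrite normalize-coprime (Coprime.sym (Coprime.1-coprimeTo c))
        | ℕ.*-identityʳ c | ℤ.+◃n≡+n c = refl

ℕtoℚ-nonNeg : ∀ c → 0ℚ ≤ ℕtoℚ c
ℕtoℚ-nonNeg c = nonNegative⁻¹ (ℕtoℚ c) {{normalize-nonNeg c 1}}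

sumFin-indicator : ∀ m (P : Fin m → Bool) →
  sumFin m (λ u → if P u then 1ℚ else 0ℚ) ≡ ℕtoℚ (countFin m P)
sumFin-indicator zero    P = refl
sumFin-indicator (suc m) P with P zero
... | true  = trans (cong (λ s → 1ℚ + s) (sumFin-indicator m (P ∘ suc)))
                    (sym (ℕtoℚ-suc (countFin m (P ∘ suc))))
... | false = trans (+-identityˡ _) (sumFin-indicator m (P ∘ suc))

anyFin≡false : ∀ n (P : Fin n → Bool) → anyFin n P ≡ false → ∀ i → P i ≡ false
anyFin≡false (suc n) P none i with P zero in P0
anyFin≡false (suc n) P ()   i       | true
anyFin≡false (suc n) P none zero    | false = P0
anyFin≡false (suc n) P none (suc i) | false = anyFin≡false n (P ∘ suc) none i

divℚ*q≡p : 0ℚ < q → divℚ p q * q ≡ p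
divℚ*q≡p {q} {p} 0<q with q ≟ 0ℚ
... | yes q≡0 = ⊥-elim (<-irrefl (sym q≡0) 0<q)
... | no  q≢0 = trans (*-assoc p (1/ q) q) (trans (cong (p *_) (*-inverseˡ q)) (*-identityʳ p))
  where instance _ = ≢-nonZero q≢0

*-divℚ-assoc : ∀ a p q → a * divℚ p q ≡ divℚ (a * p) q
*-divℚ-assoc a p q with q ≟ 0ℚ
... | yes _   = *-zeroʳ a
... | no  q≢0 = sym (*-assoc a p (1/ q))
  where instance _ = ≢-nonZero q≢0

divℚ-pos : 0ℚ < p → 0ℚ < q → 0ℚ < divℚ p q
divℚ-pos {p} {q} 0<p 0<q = *-cancelʳ-<-nonNeg q {{nonNegative (<⇒≤ 0<q)}}
  (subst₂ _<_ (sym (*-zeroˡ q)) (sym (divℚ*q≡p 0<q)) 0<p)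

divℚ-≤ : 0ℚ ≤ p → 1ℚ ≤ q → divℚ p q ≤ p
divℚ-≤ {p} {q} 0≤p 1≤q = *-cancelʳ-≤-pos q {{positive 0<q}}
  (subst₂ _≤_ (sym (divℚ*q≡p 0<q)) (*-comm q p) (p≤q*p 0≤p 1≤q))
  where 0<q = <-≤-trans 0<1 1≤q

divℚ-≤-cross : 0ℚ < q → 0ℚ < q′ → p * q′ ≤ p′ * q → divℚ p q ≤ divℚ p′ q′
divℚ-≤-cross {q} {q′} {p} {p′} 0<q 0<q′ cross =
  *-cancelʳ-≤-pos (q * q′) {{positive (*-pos 0<q 0<q′)}} (begin
  divℚ p q * (q * q′)     ≡⟨ *-assoc (divℚ p q) q q′ ⟨
  divℚ p q * q * q′       ≡⟨ cong (_* q′) (divℚ*q≡p 0<q) ⟩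
  p * q′                  ≤⟨ cross ⟩
  p′ * q                  ≡⟨ cong (_* q) (divℚ*q≡p 0<q′) ⟨
  divℚ p′ q′ * q′ * q     ≡⟨ *-assoc (divℚ p′ q′) q′ q ⟩
  divℚ p′ q′ * (q′ * q)   ≡⟨ cong (divℚ p′ q′ *_) (*-comm q′ q) ⟩
  divℚ p′ q′ * (q * q′)   ∎)
  where open ≤-Reasoning

approxRatio : ℚ → ℚ → ℚ
approxRatio k ε = 1ℚ + (k + ℕtoℚ 2) * ε

module _ (k ε : ℚ) (0≤ε : 0ℚ ≤ ε) where
  open +-*-Solver
  open ≤-Reasoning

  1+kε≤approxRatio : 1ℚ + k * ε ≤ approxRatio k ε
  1+kε≤approxRatio = begin
    1ℚ + k * ε                ≤⟨ p≤p+q (+-mono-≤ 0≤ε 0≤ε) ⟩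
    1ℚ + k * ε + (ε + ε)      ≡⟨ solve 2 (λ k ε → con 1ℚ :+ k :* ε :+ (ε :+ ε)
                                            := con 1ℚ :+ (k :+ con (ℕtoℚ 2)) :* ε) refl k ε ⟩
    approxRatio k ε           ∎

  [1+ε][1+kε]≤approxRatio : k * ε ≤ 1ℚ → (1ℚ + ε) * (1ℚ + k * ε) ≤ approxRatio k ε
  [1+ε][1+kε]≤approxRatio kε≤1 = begin
    (1ℚ + ε) * (1ℚ + k * ε)        ≡⟨ solve 2 (λ k ε → (con 1ℚ :+ ε) :* (con 1ℚ :+ k :* ε)
                                            := con 1ℚ :+ k :* ε :+ ε :+ ε :* (k :* ε)) refl k ε ⟩
    1ℚ + k * ε + ε + ε * (k * ε)   ≤⟨ +-monoʳ-≤ (1ℚ + k * ε + ε) (*-monoʳ-≤ 0≤ε kε≤1) ⟩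
    1ℚ + k * ε + ε + ε * 1ℚ        ≡⟨ solve 2 (λ k ε → con 1ℚ :+ k :* ε :+ ε :+ ε :* con 1ℚ
                                            := con 1ℚ :+ (k :+ con (ℕtoℚ 2)) :* ε) refl k ε ⟩
    approxRatio k ε                ∎

  [1+ε]²≤approxRatio : ε ≤ k → (1ℚ + ε) * (1ℚ + ε) ≤ approxRatio k ε
  [1+ε]²≤approxRatio ε≤k = begin
    (1ℚ + ε) * (1ℚ + ε)        ≡⟨ solve 1 (λ ε → (con 1ℚ :+ ε) :* (con 1ℚ :+ ε)
                                        := con 1ℚ :+ (ε :+ ε) :+ ε :* ε) refl ε ⟩
    1ℚ + (ε + ε) + ε * ε       ≤⟨ +-monoʳ-≤ (1ℚ + (ε + ε)) (*-monoʳ-≤ 0≤ε ε≤k) ⟩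
    1ℚ + (ε + ε) + ε * k       ≡⟨ solve 2 (λ k ε → con 1ℚ :+ (ε :+ ε) :+ ε :* k
                                        := con 1ℚ :+ (k :+ con (ℕtoℚ 2)) :* ε) refl k ε ⟩
    approxRatio k ε            ∎

module Cover (I : Instance) where
  open Instance I

  capacity : Fin n → ℚ
  capacity v = ℕtoℚ (cap v)

  neighbourhoodSize : (Fin n → Bool) → ℕ
  neighbourhoodSize T = countFin m (λ u → anyFin n (λ v → if adj u v then T v else false))

  capacityOutside : (Fin n → Bool) → ℚ
  capacityOutside T = sumFin n (λ v → if T v then 0ℚ else capacity v)

  weight≤cover : ∀ {y} → IsFracAlloc I y → (T : Fin n → Bool) →
    weight I y ≤ ℕtoℚ (neighbourhoodSize T) + capacityOutside T
  weight≤cover {y} isAlloc T = begin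
    weight I y
      ≤⟨ sumFin-mono m row ⟩
    sumFin m (λ u → touchesT u + sumFin n (yOff u))
      ≡⟨ sumFin-distrib-+ m touchesT _ ⟩
    sumFin m touchesT + sumFin m (λ u → sumFin n (yOff u))
      ≡⟨ cong₂ _+_ (sumFin-indicator m _) (sumFin-comm m n yOff) ⟩
    ℕtoℚ (neighbourhoodSize T) + sumFin n (λ v → sumFin m (λ u → yOff u v))
      ≤⟨ +-monoʳ-≤ (ℕtoℚ (neighbourhoodSize T)) (sumFin-mono n column) ⟩
    ℕtoℚ (neighbourhoodSize T) + capacityOutside T
      ∎
    where
    open IsFracAlloc isAlloc
    open ≤-Reasoning

    hitsT : Fin m → Bool
    hitsT u = anyFin n (λ v → if adj u v then T v else false)

    touchesT : Fin m → ℚ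
    touchesT u = if hitsT u then 1ℚ else 0ℚ

    yOff : Fin m → Fin n → ℚ
    yOff u v = if T v then 0ℚ else y u v

    yOff-nonNeg : ∀ u v → 0ℚ ≤ yOff u v
    yOff-nonNeg u v with T v
    ... | true  = ≤-refl
    ... | false = nonneg u v

    y≡yOff : ∀ u v → (if adj u v then T v else false) ≡ false → y u v ≡ yOff u v
    y≡yOff u v uv∉T with adj u v in uv | T v
    y≡yOff u v ()   | true  | true
    y≡yOff u v _    | true  | false = refl
    y≡yOff u v _    | false | false = refl
    y≡yOff u v _    | false | true  = non-edge u v uv

    row : ∀ u → sumFin n (y u) ≤ touchesT u + sumFin n (yOff u)
    row u with hitsT u in hit
    ... | true  = ≤-trans (left u) (p≤p+q (sumFin-nonNeg n (yOff-nonNeg u)))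
    ... | false = ≤-reflexive (trans (sumFin-cong n (λ v → y≡yOff u v (anyFin≡false n _ hit v)))
                                     (sym (+-identityˡ _)))

    column : ∀ v → sumFin m (λ u → yOff u v) ≤ (if T v then 0ℚ else capacity v)
    column v with T v
    ... | true  = ≤-reflexive (sumFin-zero m)
    ... | false = right v

module Proportional (I : Instance) (ε : ℚ) (kk : Fin (Instance.n I) → ℕ → ℚ) where
  open Instance I
  open Algorithm I ε kk
  open Cover I using (capacity)

  private variable
    β β′ : Fin n → ℚ
    u : Fin m
    v : Fin n

  βsum : (Fin n → ℚ) → Fin m → ℚ
  βsum β u = sumFin n (λ w → if adj u w then β w else 0ℚ)

  βsum-pos : (∀ w → 0ℚ < β w) → adj u v ≡ true → 0ℚ < βsum β u
  βsum-pos {β} {u} {v} β>0 uv = sumFin-pos n term-nonNeg v term-pos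
    where
    term-nonNeg : ∀ w → 0ℚ ≤ (if adj u w then β w else 0ℚ)
    term-nonNeg w with adj u w
    ... | true  = <⇒≤ (β>0 w)
    ... | false = ≤-refl
    term-pos : 0ℚ < (if adj u v then β v else 0ℚ)
    term-pos rewrite uv = β>0 v

  βsum-≤ : (∀ w → β′ w ≤ c * β w) → βsum β′ u ≤ c * βsum β u
  βsum-≤ {β′} {c} {β} {u} β′≤cβ =
    ≤-trans (sumFin-mono n term-≤) (≤-reflexive (sym (*-distribˡ-sumFin n c _)))
    where
    term-≤ : ∀ w → (if adj u w then β′ w else 0ℚ) ≤ c * (if adj u w then β w else 0ℚ)
    term-≤ w with adj u w
    ... | true  = β′≤cβ w
    ... | false = ≤-reflexive (sym (*-zeroʳ c))

  allocOf≡sum-xOf : ∀ β v → allocOf β v ≡ sumFin m (λ u → xOf β u v)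
  allocOf≡sum-xOf β v = sumFin-cong m on-edges
    where
    on-edges : ∀ u → (if adj u v then xOf β u v else 0ℚ) ≡ xOf β u v
    on-edges u with adj u v
    ... | true  = refl
    ... | false = refl

  xOf-nonNeg : (∀ w → 0ℚ < β w) → ∀ u v → 0ℚ ≤ xOf β u v
  xOf-nonNeg {β} β>0 u v with adj u v in uv
  ... | true  = <⇒≤ (divℚ-pos (β>0 v) (βsum-pos β>0 uv))
  ... | false = ≤-refl

  allocOf-nonNeg : (∀ w → 0ℚ < β w) → ∀ v → 0ℚ ≤ allocOf β v
  allocOf-nonNeg {β} β>0 v =
    subst (0ℚ ≤_) (sym (allocOf≡sum-xOf β v)) (sumFin-nonNeg m (λ u → xOf-nonNeg β>0 u v))

  xOf-≤ : (∀ w → 0ℚ < β w) → (∀ w → 0ℚ < β′ w) → (∀ w → β′ w ≤ c * β w) →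
          0ℚ ≤ b → a * β v ≤ b * β′ v → ∀ u → a * xOf β u v ≤ (b * c) * xOf β′ u v
  xOf-≤ {β} {β′} {c} {b} {a} {v} β>0 β′>0 β′≤cβ 0≤b aβ≤bβ′ u with adj u v in uv
  ... | false = ≤-reflexive (trans (*-zeroʳ a) (sym (*-zeroʳ (b * c))))
  ... | true  = begin
    a * divℚ (β v) S               ≡⟨ *-divℚ-assoc a (β v) S ⟩
    divℚ (a * β v) S               ≤⟨ divℚ-≤-cross (βsum-pos β>0 uv) (βsum-pos β′>0 uv) cross ⟩
    divℚ ((b * c) * β′ v) S′       ≡⟨ *-divℚ-assoc (b * c) (β′ v) S′ ⟨
    (b * c) * divℚ (β′ v) S′       ∎
    where
    open ≤-Reasoning
    S  = βsum β u
    S′ = βsum β′ u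
    cross : a * β v * S′ ≤ b * c * β′ v * S
    cross = begin
      a * β v * S′        ≤⟨ *-monoˡ-≤ (<⇒≤ (βsum-pos β′>0 uv)) aβ≤bβ′ ⟩
      b * β′ v * S′       ≤⟨ *-monoʳ-≤ (*-nonNeg 0≤b (<⇒≤ (β′>0 v)))
                                        (βsum-≤ {c = c} {β = β} {u = u} β′≤cβ) ⟩
      b * β′ v * (c * S)  ≡⟨ solve 4 (λ b c x s → b :* x :* (c :* s) := b :* c :* x :* s)
                                   refl b c (β′ v) S ⟩
      b * c * β′ v * S    ∎
      where open +-*-Solver

  allocOf-≤ : (∀ w → 0ℚ < β w) → (∀ w → 0ℚ < β′ w) → (∀ w → β′ w ≤ c * β w) →
              0ℚ ≤ b → a * β v ≤ b * β′ v → a * allocOf β v ≤ (b * c) * allocOf β′ v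
  allocOf-≤ {β} {β′} {c} {b} {a} {v} β>0 β′>0 β′≤cβ 0≤b aβ≤bβ′ = begin
    a * allocOf β v                         ≡⟨ cong (a *_) (allocOf≡sum-xOf β v) ⟩
    a * sumFin m (λ u → xOf β u v)          ≡⟨ *-distribˡ-sumFin m a _ ⟩
    sumFin m (λ u → a * xOf β u v)          ≤⟨ sumFin-mono m
                                                  (xOf-≤ {a = a} β>0 β′>0 β′≤cβ 0≤b aβ≤bβ′) ⟩
    sumFin m (λ u → b * c * xOf β′ u v)     ≡⟨ *-distribˡ-sumFin m (b * c) _ ⟨
    b * c * sumFin m (λ u → xOf β′ u v)     ≡⟨ cong (b * c *_) (allocOf≡sum-xOf β′ v) ⟨
    b * c * allocOf β′ v                    ∎
    where open ≤-Reasoning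

  threshold : Fin n → ℕ → ℚ
  threshold v r = 1ℚ + kk v r * ε

  -- Indexed by the new value so that updateCase can be stated about update r β v itself,
  -- which its case split then evaluates.
  data UpdateCase (r : ℕ) (β : Fin n → ℚ) (v : Fin n) (β′v : ℚ) : Set where
    raised  : β′v ≡ β v * (1ℚ + ε) → UpdateCase r β v β′v
    lowered : β′v ≡ divℚ (β v) (1ℚ + ε) →
              capacity v * threshold v r ≤ allocOf β v → UpdateCase r β v β′v
    held    : β′v ≡ β v →
              divℚ (capacity v) (threshold v r) < allocOf β v → UpdateCase r β v β′v

  updateCase : ∀ r β v → UpdateCase r β v (update r β v)
  updateCase r β v with allocOf β v ≤? divℚ (capacity v) (threshold v r)
  ... | yes _    = raised refl
  ... | no  ¬low with capacity v * threshold v r ≤? allocOf β v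
  ...   | yes high = lowered refl high
  ...   | no  _    = held refl (≰⇒> ¬low)

  x′-column : ∀ τ v → sumFin m (λ u → x' τ u v) ≡ capacity v ⊓ allocFinal τ v
  x′-column τ v with capacity v <? allocFinal τ v
  ... | yes C<A = begin
    sumFin m (λ u → divℚ (capacity v) (allocFinal τ v) * xFinal τ u v)
      ≡⟨ *-distribˡ-sumFin m (divℚ (capacity v) (allocFinal τ v)) (λ u → xFinal τ u v) ⟨
    divℚ (capacity v) (allocFinal τ v) * sumFin m (λ u → xFinal τ u v)
      ≡⟨ cong (divℚ (capacity v) (allocFinal τ v) *_) (allocOf≡sum-xOf _ v) ⟨
    divℚ (capacity v) (allocFinal τ v) * allocFinal τ v
      ≡⟨ divℚ*q≡p (≤-<-trans (ℕtoℚ-nonNeg (cap v)) C<A) ⟩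
    capacity v
      ≡⟨ p≤q⇒p⊓q≡p (<⇒≤ C<A) ⟨
    capacity v ⊓ allocFinal τ v ∎
    where open ≡-Reasoning
  ... | no  C≮A = trans (sym (allocOf≡sum-xOf _ v)) (sym (p≥q⇒p⊓q≡q (≮⇒≥ C≮A)))

module Dynamics (I : Instance) (ε : ℚ) (kk : Fin (Instance.n I) → ℕ → ℚ) (0<ε : 0ℚ < ε) where
  open Instance I
  open Algorithm I ε kk
  open Proportional I ε kk

  1≤1+ε : 1ℚ ≤ 1ℚ + ε
  1≤1+ε = p≤p+q (<⇒≤ 0<ε)

  0<1+ε : 0ℚ < 1ℚ + ε
  0<1+ε = <-≤-trans 0<1 1≤1+ε

  βafter-pos : ∀ r w → 0ℚ < βafter r w
  βafter-pos zero    w = 0<1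
  βafter-pos (suc r) w = by-case (updateCase (suc r) (βafter r) w)
    where
    0<β = βafter-pos r w
    by-case : ∀ {x} → UpdateCase (suc r) (βafter r) w x → 0ℚ < x
    by-case (raised  e)   = subst (0ℚ <_) (sym e) (*-pos 0<β 0<1+ε)
    by-case (lowered e _) = subst (0ℚ <_) (sym e) (divℚ-pos 0<β 0<1+ε)
    by-case (held    e _) = subst (0ℚ <_) (sym e) 0<β

  βafter-suc-≤ : ∀ r w → βafter (suc r) w ≤ (1ℚ + ε) * βafter r w
  βafter-suc-≤ r w = by-case (updateCase (suc r) (βafter r) w)
    where
    β = βafter r w
    0≤β = <⇒≤ (βafter-pos r w)
    by-case : ∀ {x} → UpdateCase (suc r) (βafter r) w x → x ≤ (1ℚ + ε) * β
    by-case (raised  e)   = ≤-reflexive (trans e (*-comm β (1ℚ + ε)))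
    by-case (lowered e _) = subst (_≤ (1ℚ + ε) * β) (sym e)
                              (≤-trans (divℚ-≤ 0≤β 1≤1+ε) (p≤q*p 0≤β 1≤1+ε))
    by-case (held    e _) = subst (_≤ (1ℚ + ε) * β) (sym e) (p≤q*p 0≤β 1≤1+ε)

  allocAfter : ℕ → Fin n → ℚ
  allocAfter r = allocOf (βafter r)

  allocAfter-nonNeg : ∀ r v → 0ℚ ≤ allocAfter r v
  allocAfter-nonNeg r = allocOf-nonNeg (βafter-pos r)

  allocAfter-≤-suc : ∀ a b r v → 0ℚ ≤ b → a * βafter r v ≤ b * βafter (suc r) v →
                     a * allocAfter r v ≤ (b * (1ℚ + ε)) * allocAfter (suc r) v
  allocAfter-≤-suc a b r v = allocOf-≤ {a = a} (βafter-pos r) (βafter-pos (suc r)) (βafter-suc-≤ r)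

  raised⇒allocAfter-≤ : ∀ r v → βafter (suc r) v ≡ βafter r v * (1ℚ + ε) →
                         allocAfter r v ≤ allocAfter (suc r) v
  raised⇒allocAfter-≤ r v raised-v = *-cancelˡ-≤-pos (1ℚ + ε) {{positive 0<1+ε}} (begin
    (1ℚ + ε) * allocAfter r v                ≤⟨ allocAfter-≤-suc (1ℚ + ε) 1ℚ r v (<⇒≤ 0<1) step ⟩
    1ℚ * (1ℚ + ε) * allocAfter (suc r) v     ≡⟨ cong (_* allocAfter (suc r) v)
                                                      (*-identityˡ (1ℚ + ε)) ⟩
    (1ℚ + ε) * allocAfter (suc r) v          ∎)
    where
    open ≤-Reasoning
    step : (1ℚ + ε) * βafter r v ≤ 1ℚ * βafter (suc r) v
    step = ≤-reflexive (trans (*-comm (1ℚ + ε) (βafter r v))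
                         (trans (sym raised-v) (sym (*-identityˡ (βafter (suc r) v)))))

module Guarantee (I : Instance) (ε : ℚ) (kk : Fin (Instance.n I) → ℕ → ℚ) (0<ε : 0ℚ < ε)
                 (k : ℚ) (0<k : 0ℚ < k) (kε≤1 : k * ε ≤ 1ℚ) (0<kk : ∀ v r → 0ℚ < kk v r) where
  open Instance I
  open Algorithm I ε kk
  open Cover I
  open Proportional I ε kk
  open Dynamics I ε kk 0<ε

  D : ℚ
  D = approxRatio k ε

  0≤ε : 0ℚ ≤ ε
  0≤ε = <⇒≤ 0<ε

  0≤1+kε : 0ℚ ≤ 1ℚ + k * ε
  0≤1+kε = ≤-trans (<⇒≤ 0<1) (p≤p+q (*-nonNeg (<⇒≤ 0<k) 0≤ε))

  1≤D : 1ℚ ≤ D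
  1≤D = ≤-trans (p≤p+q (*-nonNeg (<⇒≤ 0<k) 0≤ε)) (1+kε≤approxRatio k ε 0≤ε)

  0≤D : 0ℚ ≤ D
  0≤D = ≤-trans (<⇒≤ 0<1) 1≤D

  ε≤k : 1ℚ ≤ k → ε ≤ k
  ε≤k 1≤k = ≤-trans (subst (_≤ k * ε) (*-identityˡ ε) (*-monoˡ-≤ 0≤ε 1≤k)) (≤-trans kε≤1 1≤k)

  Covered : Fin n → ℕ → Set
  Covered v r = capacity v ≤ D * allocAfter r v

  1≤threshold : ∀ v r → 1ℚ ≤ threshold v r
  1≤threshold v r = p≤p+q (*-nonNeg (<⇒≤ (0<kk v r)) 0≤ε)

  held⇒covered : ∀ r v → kk v (suc r) ≤ k → βafter (suc r) v ≡ βafter r v →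
                 divℚ (capacity v) (threshold v (suc r)) < allocAfter r v →
                 Covered v r × Covered v (suc r)
  held⇒covered r v kk≤k held-v over =
    ≤-trans C≤[1+kε]A (*-monoˡ-≤ 0≤A (1+kε≤approxRatio k ε 0≤ε)) , (begin
      capacity v                          ≤⟨ C≤[1+kε]A ⟩
      (1ℚ + k * ε) * A                    ≤⟨ *-monoʳ-≤ 0≤1+kε A≤[1+ε]A′ ⟩
      (1ℚ + k * ε) * ((1ℚ + ε) * A′)      ≡⟨ solve 4 (λ a b x y → a :* (b :* y) := b :* a :* y) refl
                                                    (1ℚ + k * ε) (1ℚ + ε) A A′ ⟩
      (1ℚ + ε) * (1ℚ + k * ε) * A′        ≤⟨ *-monoˡ-≤ (allocAfter-nonNeg (suc r) v)
                                                    ([1+ε][1+kε]≤approxRatio k ε 0≤ε kε≤1) ⟩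
      D * A′                              ∎)
    where
    open ≤-Reasoning
    open +-*-Solver
    t  = threshold v (suc r)
    A  = allocAfter r v
    A′ = allocAfter (suc r) v
    0≤A : 0ℚ ≤ A
    0≤A = allocAfter-nonNeg r v
    0<t : 0ℚ < t
    0<t = <-≤-trans 0<1 (1≤threshold v (suc r))
    C≤[1+kε]A : capacity v ≤ (1ℚ + k * ε) * A
    C≤[1+kε]A = begin
      capacity v                          ≡⟨ divℚ*q≡p 0<t ⟨
      divℚ (capacity v) t * t             ≤⟨ <⇒≤ (*-monoˡ-<-pos t {{positive 0<t}} over) ⟩
      A * t                               ≤⟨ *-monoʳ-≤ 0≤A (+-monoʳ-≤ 1ℚ (*-monoˡ-≤ 0≤ε kk≤k)) ⟩
      A * (1ℚ + k * ε)                    ≡⟨ *-comm A _ ⟩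
      (1ℚ + k * ε) * A                    ∎
    A≤[1+ε]A′ : A ≤ (1ℚ + ε) * A′
    A≤[1+ε]A′ = subst₂ _≤_ (*-identityˡ A) (cong (_* A′) (*-identityˡ (1ℚ + ε)))
      (allocAfter-≤-suc 1ℚ 1ℚ r v (<⇒≤ 0<1) (≤-reflexive (cong (1ℚ *_) (sym held-v))))

  lowered⇒covered : ∀ r v → ε ≤ k → βafter (suc r) v ≡ divℚ (βafter r v) (1ℚ + ε) →
                    capacity v * threshold v (suc r) ≤ allocAfter r v →
                    Covered v r × Covered v (suc r)
  lowered⇒covered r v ε≤k lowered-v over = ≤-trans C≤A (p≤q*p 0≤A 1≤D) , (begin
      capacity v                      ≤⟨ C≤A ⟩
      A                               ≤⟨ A≤[1+ε]²A′ ⟩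
      (1ℚ + ε) * (1ℚ + ε) * A′        ≤⟨ *-monoˡ-≤ (allocAfter-nonNeg (suc r) v)
                                                ([1+ε]²≤approxRatio k ε 0≤ε ε≤k) ⟩
      D * A′                          ∎)
    where
    open ≤-Reasoning
    A  = allocAfter r v
    A′ = allocAfter (suc r) v
    0≤A : 0ℚ ≤ A
    0≤A = allocAfter-nonNeg r v
    C≤A : capacity v ≤ A
    C≤A = ≤-trans (subst (capacity v ≤_) (*-comm _ (capacity v))
                    (p≤q*p (ℕtoℚ-nonNeg (cap v)) (1≤threshold v (suc r)))) over
    β≤[1+ε]β′ : 1ℚ * βafter r v ≤ (1ℚ + ε) * βafter (suc r) v
    β≤[1+ε]β′ = ≤-reflexive (begin-equality
      1ℚ * βafter r v                           ≡⟨ *-identityˡ (βafter r v) ⟩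
      βafter r v                                ≡⟨ divℚ*q≡p 0<1+ε ⟨
      divℚ (βafter r v) (1ℚ + ε) * (1ℚ + ε)     ≡⟨ *-comm _ (1ℚ + ε) ⟩
      (1ℚ + ε) * divℚ (βafter r v) (1ℚ + ε)     ≡⟨ cong ((1ℚ + ε) *_) lowered-v ⟨
      (1ℚ + ε) * βafter (suc r) v               ∎)
    A≤[1+ε]²A′ : A ≤ (1ℚ + ε) * (1ℚ + ε) * A′
    A≤[1+ε]²A′ = subst (_≤ (1ℚ + ε) * (1ℚ + ε) * A′) (*-identityˡ A)
      (allocAfter-≤-suc 1ℚ (1ℚ + ε) r v (<⇒≤ 0<1+ε) β≤[1+ε]β′)

  module _ (τ : ℕ) (kk-bounds : ∀ v r → 1 ℕ.≤ r → r ℕ.≤ τ → 1ℚ ≤ k * kk v r × kk v r ≤ k) where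

    AlwaysRaised : Fin n → ℕ → Set
    AlwaysRaised v r = βafter r v ≡ powℚ (1ℚ + ε) r

    -- allocAfter r is the allocation computed in round r + 1, so for r = τ the first
    -- component of the pair concerns the final round.
    alwaysRaised⊎covered : ∀ v r → r ℕ.≤ τ →
                           AlwaysRaised v r ⊎ (Covered v (r ℕ.∸ 1) × Covered v r)
    alwaysRaised⊎covered v zero    _    = inj₁ refl
    alwaysRaised⊎covered v (suc r) r<τ =
      by-case (alwaysRaised⊎covered v r (ℕ.<⇒≤ r<τ)) (updateCase (suc r) (βafter r) v)
      where
      round-bounds = kk-bounds v (suc r) (ℕ.s≤s ℕ.z≤n) r<τ
      1≤k = 1≤p*q⇒q≤p⇒1≤p (<⇒≤ 0<k) (proj₁ round-bounds) (proj₂ round-bounds)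
      by-case : AlwaysRaised v r ⊎ (Covered v (r ℕ.∸ 1) × Covered v r) →
                UpdateCase (suc r) (βafter r) v (βafter (suc r) v) →
                AlwaysRaised v (suc r) ⊎ (Covered v r × Covered v (suc r))
      by-case (inj₁ always)       (raised e)       =
        inj₁ (trans e (trans (cong (_* (1ℚ + ε)) always) (*-comm (powℚ (1ℚ + ε) r) (1ℚ + ε))))
      by-case (inj₂ (_ , covered)) (raised e)      =
        inj₂ (covered , ≤-trans covered (*-monoʳ-≤ 0≤D (raised⇒allocAfter-≤ r v e)))
      by-case _                   (held e over)    =
        inj₂ (held⇒covered r v (proj₂ round-bounds) e over)
      by-case _                   (lowered e over) =
        inj₂ (lowered⇒covered r v (ε≤k 1≤k) e over)

    alwaysRaised⇒top : ∀ v → AlwaysRaised v τ → inTopLevel τ v ≡ true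
    alwaysRaised⇒top v always with βafter τ v ≟ powℚ (1ℚ + ε) τ
    ... | yes _ = refl
    ... | no  ≢ = ⊥-elim (≢ always)

    notTop⇒covered : ∀ v → inTopLevel τ v ≡ false → Covered v (τ ℕ.∸ 1)
    notTop⇒covered v notTop = [ absurd , proj₁ ] (alwaysRaised⊎covered v τ ℕ.≤-refl)
      where
      absurd : AlwaysRaised v τ → Covered v (τ ℕ.∸ 1)
      absurd always = contradiction (trans (sym (alwaysRaised⇒top v always)) notTop) λ ()

    capacityOutsideTop≤ : capacityOutside (inTopLevel τ) ≤ D * MatchWeight τ
    capacityOutsideTop≤ = begin
      capacityOutside (inTopLevel τ)                          ≤⟨ sumFin-mono n bound ⟩
      sumFin n (λ v → D * (capacity v ⊓ allocFinal τ v))      ≡⟨ *-distribˡ-sumFin n D _ ⟨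
      D * sumFin n (λ v → capacity v ⊓ allocFinal τ v)        ≡⟨ cong (D *_) matched ⟨
      D * MatchWeight τ                                       ∎
      where
      open ≤-Reasoning
      matched : MatchWeight τ ≡ sumFin n (λ v → capacity v ⊓ allocFinal τ v)
      matched = trans (sumFin-comm m n (x' τ)) (sumFin-cong n (x′-column τ))
      bound : ∀ v → (if inTopLevel τ v then 0ℚ else capacity v) ≤ D * (capacity v ⊓ allocFinal τ v)
      bound v = by-case (inTopLevel τ v) refl
        where
        by-case : ∀ b → inTopLevel τ v ≡ b →
                  (if b then 0ℚ else capacity v) ≤ D * (capacity v ⊓ allocFinal τ v)
        by-case true  _      =
          *-nonNeg 0≤D (⊓-glb (ℕtoℚ-nonNeg (cap v)) (allocAfter-nonNeg (τ ℕ.∸ 1) v))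
        by-case false notTop =
          subst (capacity v ≤_) (sym (*-distribˡ-⊓-nonNeg D {{nonNegative 0≤D}} _ _))
            (⊓-glb (p≤q*p (ℕtoℚ-nonNeg (cap v)) 1≤D) (notTop⇒covered v notTop))

lemma7 : (I : Instance) → (∀ v → 1 ℕ.≤ Instance.cap I v) →
  (τ : ℕ) → 1 ℕ.≤ τ →
  (ε : ℚ) → 0ℚ < ε → ε ≤ (+ 1) / 4 →
  (k : ℚ) → 0ℚ < k → k * ε ≤ 1ℚ →
  (kk : Fin (Instance.n I) → ℕ → ℚ) →
  (∀ v r → 0ℚ < kk v r) →
  (∀ v r → 1 ℕ.≤ r → r ℕ.≤ τ → 1ℚ ≤ k * kk v r × kk v r ≤ k) →
  (y : Fin (Instance.m I) → Fin (Instance.n I) → ℚ) → IsFracAlloc I y →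
  weight I y ≤
    (1ℚ + (k + ℕtoℚ 2) * ε) * Algorithm.MatchWeight I ε kk τ
      + ℕtoℚ (Algorithm.sizeNTop I ε kk τ)
lemma7 I _ τ _ ε 0<ε _ k 0<k kε≤1 kk 0<kk kk-bounds y isAlloc = begin
  weight I y
    ≤⟨ weight≤cover isAlloc (inTopLevel τ) ⟩
  ℕtoℚ (sizeNTop τ) + capacityOutside (inTopLevel τ)
    ≤⟨ +-monoʳ-≤ (ℕtoℚ (sizeNTop τ)) (capacityOutsideTop≤ τ kk-bounds) ⟩
  ℕtoℚ (sizeNTop τ) + D * MatchWeight τ
    ≡⟨ +-comm (ℕtoℚ (sizeNTop τ)) (D * MatchWeight τ) ⟩
  D * MatchWeight τ + ℕtoℚ (sizeNTop τ)
    ∎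
  where
  open ≤-Reasoning
  open Algorithm I ε kk
  open Cover I
  open Guarantee I ε kk 0<ε k 0<k kε≤1 0<kk
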